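{- If $\varphi$ is a formula with $\mathrm{dpt}(\varphi)\leq n$ and $\mathrm{wdt}(\varphi)< k$ and $\mathfrak X,\mathfrak Y$ are finite dtm's, then whenever $\langle\mathfrak X,x\rangle\mathrel{\underline{\leftrightarrow}}^{n}_k \langle\mathfrak Y,y\rangle$, we have that $x\in[\![\varphi]\!]_\mathfrak X$ if and only if $y\in[\![\varphi]\!]_\mathfrak Y$.
   Context: The language $\mathsf L^\ast$ is built from a countable set of propositional variables $p_1,p_2,\dots$ using $\wedge,\neg$, the unary temporal modalities $f$ (`next') and $[f]$ (`henceforth'), and a polyadic modality $\Diamond$ applied to finite sets of formulas: if $\Gamma$ is finite, $\Diamond\Gamma$ is a formula ($\Diamond\gamma$ abbreviates $\Diamond\{\gamma\}$, $\Box=\neg\Diamond\neg$, $\langle f\rangle=\neg[f]\neg$). $\mathrm{dpt}(\varphi)$ is the modal nesting depth of $\varphi$ and $\mathrm{wdt}(\varphi)$ is the largest $k$ such that $\varphi$ has a subformula of the form $\Diamond\{\gamma_1,\dots,\gamma_k\}$. A dynamic topological model (dtm) is a topological space $|\mathfrak X|$ with a continuous $f_\mathfrak X:|\mathfrak X|\to|\mathfrak X|$ and a valuation $[\![\cdot]\!]_\mathfrak X$ (the set of points where a formula holds) with the Boolean clauses, $[\![f\alpha]\!]=f^{ -1}[\![\alpha]\!]$, $[\![[f]\alpha]\!]=\bigcap_{n\ge 0}f^{ -n}[\![\alpha]\!]$, and $[\![\Diamond\{\alpha_1,\dots,\alpha_n\}]\!]$ equal to the tangled closure of $\{[\![\alpha_1]\!],\dots,[\![\alpha_n]\!]\}$,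 namely the union of all sets $E$ such that every $[\![\alpha_i]\!]\cap E$ is dense in $E$. A finite dtm here is a finite preorder $\langle|\mathfrak X|,\preccurlyeq\rangle$ with the downset topology (a set is open iff it contains $\{v: v\preccurlyeq w\}$ for each of its points $w$); there $x$ lies in the tangled closure of $\{A_1,\dots,A_n\}$ iff there are $y_i\in A_i$ with $y_i\preccurlyeq x$ and all $y_i$ mutually $\approx$-equivalent ($w\approx v$ means $w\preccurlyeq v$ and $v\preccurlyeq w$). Tangled partial bisimulation: for $n<\omega$, $k\le\omega$, the relation $\mathrel{\underline{\leftrightarrow}}^n_k\subseteq|\mathfrak X|\times|\mathfrak Y|$ is defined by: $x\mathrel{\underline{\leftrightarrow}}^0_k y$ iff $x,y$ satisfy the same atoms; $x\mathrel{\underline{\leftrightarrow}}^{n+1}_k y$ iff $x,y$ satisfy the same atoms and (Forth$_\preccurlyeq$) whenever $m<k$ and $x_1\approx\dots\approx x_m\preccurlyeq x$ there are $y_1\approx\dots\approx y_m\preccurlyeq y$ with $x_i\mathrel{\underline{\leftrightarrow}}^n_k y_i$ for all $i$; (Back$_\preccurlyeq$) symmetrically; (Forth$_f$) $f_\mathfrak X(x)\mathrel{\underline{\leftrightarrow}}^n_k f_\mathfrak Y(y)$; (Forth$_{[f]}$) for every $m$ there is $m'$ with $f^m_\mathfrak X(x)\mathrel{\underline{\leftrightarrow}}^n_k f^{m'}_\mathfrak Y(y)$; (Back$_{[f]}$) for every $m$ there is $m'$ with $f^m_\mathfrak Y(y)\mathrel{\underline{\leftrightarrow}}^n_k f^{m'}_\mathfrak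 X(x)$. $\mathrel{\underline{\leftrightarrow}}^n_\ast$ denotes the case $k=\omega$. -}

module Defs where

open import Data.Nat using (ℕ; zero; suc; _⊔_; _<_)
open import Data.Fin using (Fin; zero; suc)
open import Data.Bool using (Bool; true)
open import Data.List using (List; []; _∷_; length)
open import Data.Product using (Σ; _×_; ∃)
open import Data.Unit using (⊤)
open import Data.Empty using (⊥)
open import Relation.Binary.PropositionalEquality using (_≡_)
open import Function using (_∘_)

-- The language L*.  Finite sets of formulas Γ in ◇Γ are given as lists.

data Form : Set where
  var  : ℕ → Form
  _∧_  : Form → Form → Form
  ¬_   : Form → Form
  nxt  : Form → Form
  hnc  : Form → Form
  dia  : List Form → Form

mutual
  dpt : Form → ℕ
  dpt (var _)   = 0
  dpt (φ ∧ ψ)   = dpt φ ⊔ dpt ψ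
  dpt (¬ φ)     = dpt φ
  dpt (nxt φ)   = suc (dpt φ)
  dpt (hnc φ)   = suc (dpt φ)
  dpt (dia Γ)   = suc (dptL Γ)

  dptL : List Form → ℕ
  dptL []      = 0
  dptL (γ ∷ Γ) = dpt γ ⊔ dptL Γ

mutual
  wdt : Form → ℕ
  wdt (var _)   = 0
  wdt (φ ∧ ψ)   = wdt φ ⊔ wdt ψ
  wdt (¬ φ)     = wdt φ
  wdt (nxt φ)   = wdt φ
  wdt (hnc φ)   = wdt φ
  wdt (dia Γ)   = length Γ ⊔ wdtL Γ

  wdtL : List Form → ℕ
  wdtL []      = 0
  wdtL (γ ∷ Γ) = wdt γ ⊔ wdtL Γ

data Bound : Set where
  fin : ℕ → Bound
  ω   : Bound

_<ᵏ_ : ℕ → Bound → Set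
m <ᵏ fin k = m < k
m <ᵏ ω     = ⊤

-- Finite dynamic topological models: a finite preorder with the downset
-- topology, a continuous map and a valuation.

record FDTM : Set₁ where
  field
    size  : ℕ
    _≼_   : Fin size → Fin size → Set
    ≼-refl  : ∀ x → x ≼ x
    ≼-trans : ∀ {x y z} → x ≼ y → y ≼ z → x ≼ z
    fmap  : Fin size → Fin size
    val   : ℕ → Fin size → Bool

  IsOpen : (Fin size → Bool) → Set
  IsOpen U = ∀ w v → U w ≡ true → v ≼ w → U v ≡ true

  field
    continuous : ∀ (U : Fin size → Bool) → IsOpen U → IsOpen (U ∘ fmap)

  _≈_ : Fin size → Fin size → Set
  w ≈ v = (w ≼ v) × (v ≼ w)

  iter : ℕ → Fin size → Fin size
  iter zero    x = x
  iter (suc m) x = fmap (iter m x)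

  -- truth of formulas;  ◇{γ₁..γₘ} holds at x iff there are y_i ⊨ γ_i,
  -- y_i ≼ x, with all y_i mutually ≈-equivalent (tangled closure on a
  -- finite preorder with the downset topology).
  mutual
    _⊨_ : Fin size → Form → Set
    x ⊨ var p   = val p x ≡ true
    x ⊨ (φ ∧ ψ) = (x ⊨ φ) × (x ⊨ ψ)
    x ⊨ (¬ φ)   = x ⊨ φ → ⊥
    x ⊨ nxt φ   = fmap x ⊨ φ
    x ⊨ hnc φ   = ∀ n → iter n x ⊨ φ
    x ⊨ dia Γ   = Σ (Fin (length Γ) → Fin size) λ ys →
                    (∀ i j → ys i ≈ ys j) × (∀ i → ys i ≼ x) × SatAll Γ ys

    SatAll : (Γ : List Form) → (Fin (length Γ) → Fin size) → Set
    SatAll []      ys = ⊤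
    SatAll (γ ∷ Γ) ys = (ys zero ⊨ γ) × SatAll Γ (ys ∘ suc)

module _ (X Y : FDTM) where
  private
    module X = FDTM X
    module Y = FDTM Y

  Bisim : ℕ → Bound → Fin X.size → Fin Y.size → Set
  Bisim zero    k x y = ∀ p → X.val p x ≡ Y.val p y
  Bisim (suc n) k x y =
      (∀ p → X.val p x ≡ Y.val p y)
    × (∀ m → m <ᵏ k → (xs : Fin m → Fin X.size)
         → (∀ i j → xs i X.≈ xs j) → (∀ i → xs i X.≼ x)
         → Σ (Fin m → Fin Y.size) λ ys →
             (∀ i j → ys i Y.≈ ys j) × (∀ i → ys i Y.≼ y)
             × (∀ i → Bisim n k (xs i) (ys i)))
    × (∀ m → m <ᵏ k → (ys : Fin m → Fin Y.size)
         → (∀ i j → ys i Y.≈ ys j) → (∀ i → ys i Y.≼ y)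
         → Σ (Fin m → Fin X.size) λ xs →
             (∀ i j → xs i X.≈ xs j) × (∀ i → xs i X.≼ x)
             × (∀ i → Bisim n k (xs i) (ys i)))
    × Bisim n k (X.fmap x) (Y.fmap y)
    × (∀ m → ∃ λ m' → Bisim n k (X.iter m x) (Y.iter m' y))
    × (∀ m → ∃ λ m' → Bisim n k (X.iter m' x) (Y.iter m y))

module Submission where

-- The proof is by induction on the formula, but only in ONE direction:
-- we show that truth is transported from x to y along  x ↔ⁿₖ y.
-- The converse direction then comes for free, because the relation
-- ↔ⁿₖ is symmetric (Back and Forth clauses swap under exchanging the
-- two models).  Symmetry is also what makes the negation case of the
-- one-directional induction go through.

open import Defs
open import Data.Nat using (ℕ; zero; suc; _≤_; _⊔_; s≤s)
open import Data.Nat.Properties using (≤-<-trans; m≤m⊔n; m≤n⊔m; m⊔n≤o⇒m≤o; m⊔n≤o⇒n≤o)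
open import Data.Fin using (Fin; zero; suc)
open import Data.List using (List; []; _∷_; length)
open import Data.Product using (_×_; _,_)
open import Data.Unit using (tt)
open import Function using (_∘_)
open import Relation.Binary.PropositionalEquality using (_≡_; sym; trans)

⟨_,_⟩⊨_ : (X : FDTM) → Fin (FDTM.size X) → Form → Set
⟨ X , x ⟩⊨ φ = FDTM._⊨_ X x φ

<ᵏ-≤ : ∀ {a b} (k : Bound) → a ≤ b → b <ᵏ k → a <ᵏ k
<ᵏ-≤ (fin k) a≤b b<k = ≤-<-trans a≤b b<k
<ᵏ-≤ ω       _   _   = tt

<ᵏ-⊔ˡ : ∀ a b (k : Bound) → (a ⊔ b) <ᵏ k → a <ᵏ k
<ᵏ-⊔ˡ a b k = <ᵏ-≤ k (m≤m⊔n a b)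

<ᵏ-⊔ʳ : ∀ a b (k : Bound) → (a ⊔ b) <ᵏ k → b <ᵏ k
<ᵏ-⊔ʳ a b k = <ᵏ-≤ k (m≤n⊔m a b)

-- ↔ⁿₖ is symmetric: exchanging the models swaps Forth and Back.
bisim-sym : ∀ {X Y : FDTM} n {k x y} → Bisim X Y n k x y → Bisim Y X n k y x
bisim-sym zero atoms = λ p → sym (atoms p)
bisim-sym (suc n) (atoms , forth , back , next , hncForth , hncBack) =
    (λ p → sym (atoms p))
  , (λ m m<k ys ≈ys ≼y → let (xs , ≈xs , ≼x , bs) = back m m<k ys ≈ys ≼y
                         in xs , ≈xs , ≼x , λ i → bisim-sym n (bs i))
  , (λ m m<k xs ≈xs ≼x → let (ys , ≈ys , ≼y , bs) = forth m m<k xs ≈xs ≼x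
                         in ys , ≈ys , ≼y , λ i → bisim-sym n (bs i))
  , bisim-sym n next
  , (λ m → let (m' , b) = hncBack m in m' , bisim-sym n b)
  , (λ m → let (m' , b) = hncForth m in m' , bisim-sym n b)

sameAtoms : ∀ {X Y : FDTM} n {k x y} → Bisim X Y n k x y
          → ∀ p → FDTM.val X p x ≡ FDTM.val Y p y
sameAtoms zero    atoms       = atoms
sameAtoms (suc n) (atoms , _) = atoms

module Transfer (k : Bound) where
  mutual
    transfer : ∀ {X Y : FDTM} n φ → dpt φ ≤ n → wdt φ <ᵏ k
             → ∀ {x y} → Bisim X Y n k x y → ⟨ X , x ⟩⊨ φ → ⟨ Y , y ⟩⊨ φ
    transfer n (var p) d w b x⊨p = trans (sym (sameAtoms n b p)) x⊨p
    transfer n (φ ∧ ψ) d w b (x⊨φ , x⊨ψ) =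
        transfer n φ (m⊔n≤o⇒m≤o (dpt φ) (dpt ψ) d) (<ᵏ-⊔ˡ (wdt φ) (wdt ψ) k w) b x⊨φ
      , transfer n ψ (m⊔n≤o⇒n≤o (dpt φ) (dpt ψ) d) (<ᵏ-⊔ʳ (wdt φ) (wdt ψ) k w) b x⊨ψ
    transfer n (¬ φ) d w b x⊭φ y⊨φ = x⊭φ (transfer n φ d w (bisim-sym n b) y⊨φ)
    transfer (suc n) (nxt φ) (s≤s d) w (_ , _ , _ , next , _ , _) x⊨φ =
      transfer n φ d w next x⊨φ
    transfer (suc n) (hnc φ) (s≤s d) w (_ , _ , _ , _ , _ , hncBack) x⊨□φ m =
      let (m' , b) = hncBack m in transfer n φ d w b (x⊨□φ m')
    transfer (suc n) (dia Γ) (s≤s d) w (_ , forth , _) (xs , ≈xs , ≼x , xs⊨Γ) =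
      let (ys , ≈ys , ≼y , bs) = forth (length Γ) (<ᵏ-⊔ˡ (length Γ) (wdtL Γ) k w) xs ≈xs ≼x
      in ys , ≈ys , ≼y , transferAll n Γ d (<ᵏ-⊔ʳ (length Γ) (wdtL Γ) k w) bs xs⊨Γ

    transferAll : ∀ {X Y : FDTM} n Γ → dptL Γ ≤ n → wdtL Γ <ᵏ k
                → ∀ {xs : Fin (length Γ) → Fin (FDTM.size X)}
                    {ys : Fin (length Γ) → Fin (FDTM.size Y)}
                → (∀ i → Bisim X Y n k (xs i) (ys i))
                → FDTM.SatAll X Γ xs → FDTM.SatAll Y Γ ys
    transferAll n [] d w bs _ = tt
    transferAll n (γ ∷ Γ) d w bs (x⊨γ , xs⊨Γ) =
        transfer n γ (m⊔n≤o⇒m≤o (dpt γ) (dptL Γ) d) (<ᵏ-⊔ˡ (wdt γ) (wdtL Γ) k w) (bs zero) x⊨γ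
      , transferAll n Γ (m⊔n≤o⇒n≤o (dpt γ) (dptL Γ) d) (<ᵏ-⊔ʳ (wdt γ) (wdtL Γ) k w) (bs ∘ suc) xs⊨Γ

open Transfer using (transfer)

mainTheorem1 : (X Y : FDTM) (n : ℕ) (k : Bound) (φ : Form)
    → dpt φ ≤ n → wdt φ <ᵏ k
    → (x : Fin (FDTM.size X)) (y : Fin (FDTM.size Y))
    → Bisim X Y n k x y
    → ((FDTM._⊨_ X x φ → FDTM._⊨_ Y y φ) × (FDTM._⊨_ Y y φ → FDTM._⊨_ X x φ))
mainTheorem1 X Y n k φ d w x y b =
  transfer k n φ d w b , transfer k n φ d w (bisim-sym n b)
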